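{- Let $m,n\ge 2$ be integers and $H=H_{1\times m\times n}$. Then the intersection of the perfect matchings $P(0,\dots,0)$ and $P(n,\dots,n)$ of $H$ (equivalently, the intersection of the corresponding facets of the perfect matching complex $\mathcal{M}_p(H)$) is exactly the set of significant edges $\{d_{i,j}: 1\le i\le m-1,\ 1\le j\le n-1\}$.
   Context: For a finite simple graph $G$, the perfect matching complex $\mathcal{M}_p(G)$ is the simplicial complex on vertex set $E(G)$ whose faces are the subsets of perfect matchings of $G$. For integers $m,n\ge 1$, $H_{1\times m\times n}$ is the planar graph formed by hexagonal cells $T_{i,j}$ ($1\le i\le m$, $1\le j\le n$) of the hexagonal lattice arranged as a parallelogram: each hexagon has a horizontal top and bottom edge; $T_{i,j+1}$ lies directly above $T_{i,j}$ sharing the top edge of $T_{i,j}$; $T_{i+1,j}$ shares the lower-right edge of $T_{i,j}$; $T_{i+1,j+1}$ shares the upper-right edge of $T_{i,j}$. Edges are labeled so that in cell $T_{i,j}$ the top edge is $a_{i,j}$, the bottom edge is $a_{i,j-1}$, the upper-left edge is $b_{i-1,j}$, the lower-right edge is $b_{i,j}$, the upper-right edge is $d_{i,j}$ and the lower-left edge is $d_{i-1,j-1}$. The significant edges are the edges $d_{i,j}$ shared by $T_{i,j}$ and $T_{i+1,j+1}$, $1\le i\le m-1$, $1\le j\le n-1$. Perfect matchings of $H$ correspond bijectively to sequences $n\ge h_1\ge\cdots\ge h_m\ge 0$: with $h_0=n$, $h_{m+1}=0$, the matching $P(h_1,\dots,h_m)$ consists of the edges $a_{i,j}$ with $j=h_i$,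 the edges $b_{i,j}$ with $h_i\ge j>h_{i+1}$, and the edges $d_{i,j}$ with $j>h_i$ or $j<h_{i+1}$. -}

module Defs where

open import Data.Nat using (ℕ; zero; suc; _≤_; _<_; _∸_; _≤?_)
open import Data.Product using (_×_; ∃-syntax)
open import Data.Sum using (_⊎_)
open import Relation.Nullary using (yes; no)
open import Relation.Binary.PropositionalEquality using (_≡_)

data Label : Set where
  a b d : ℕ → ℕ → Label

-- Which labels are actual edges of H_{1×m×n}, read off from the cell labelling:
--  a_{i,j}: top of T_{i,j} / bottom of T_{i,j+1}:       1 ≤ i ≤ m, 0 ≤ j ≤ n
--  b_{i,j}: lower-right of T_{i,j} / upper-left of T_{i+1,j}: 0 ≤ i ≤ m, 1 ≤ j ≤ n
--  d_{i,j}: upper-right of T_{i,j} (1≤i≤m,1≤j≤n) or lower-left of T_{i+1,j+1} (0≤i≤m-1, 0≤j≤n-1)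
IsEdge : ℕ → ℕ → Label → Set
IsEdge m n (a i j) = 1 ≤ i × i ≤ m × j ≤ n
IsEdge m n (b i j) = i ≤ m × 1 ≤ j × j ≤ n
IsEdge m n (d i j) = (1 ≤ i × i ≤ m × 1 ≤ j × j ≤ n) ⊎ (i < m × j < n)

ext : ℕ → ℕ → (ℕ → ℕ) → ℕ → ℕ
ext m n h zero = n
ext m n h (suc k) with suc k ≤? m
... | yes _ = h (suc k)
... | no _  = 0

InP : ℕ → ℕ → (ℕ → ℕ) → Label → Set
InP m n h (a i j) = j ≡ ext m n h i
InP m n h (b i j) = j ≤ ext m n h i × ext m n h (suc i) < j
InP m n h (d i j) = ext m n h i < j ⊎ j < ext m n h (suc i)

Significant : ℕ → ℕ → Label → Set
Significant m n e =
  ∃[ i ] ∃[ j ] (e ≡ d i j × 1 ≤ i × i ≤ m ∸ 1 × 1 ≤ j × j ≤ n ∸ 1)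

-- Padded with h₀ = n and h_{m+1} = 0, the sequences of P(0,…,0) and P(n,…,n) are
-- (n,0,…,0,0) and (n,n,…,n,0). An a-edge a_{i,j} would need j = 0 and j = n; a
-- b-edge would need 1 ≤ j ≤ 0 (for i ≥ 1) or n < j ≤ n (for i = 0). So a common
-- edge is some d_{i,j}: membership in P(0,…,0) excludes i = 0 and forces 0 < j, and
-- membership in P(n,…,n) rules out n < j, leaving j < h_{i+1}, i.e. i < m and j < n.
module Submission where

open import Defs
open import Data.Nat using (ℕ; zero; suc; _≤_; _<_; _≤?_; z≤n; s≤s; pred)
open import Data.Nat.Properties using (<⇒≢; <⇒≱; <⇒≤pred; ≤-trans; n≤1+n)
open import Data.Product using (_×_; _,_; uncurry)
open import Data.Sum using (inj₁; inj₂)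
open import Function.Base using (const)
open import Function.Bundles using (_⇔_; mk⇔)
open import Relation.Nullary using (yes; no; contradiction)
open import Relation.Binary.PropositionalEquality using (_≡_; refl; sym; trans; subst)

private
  variable
    m i j : ℕ

≤pred⇒< : 1 ≤ i → i ≤ pred m → i < m
≤pred⇒< {m = zero}  (s≤s _) ()
≤pred⇒< {m = suc _} _       i≤pred = s≤s i≤pred

module _ (m n : ℕ) where

  ext-inner : ∀ h → 1 ≤ i → i ≤ m → ext m n h i ≡ h i
  ext-inner {i = suc k} h _ i≤m with suc k ≤? m
  ... | yes _    = refl
  ... | no  i≰m  = contradiction i≤m i≰m

  ext-const0-suc : ∀ i → ext m n (const 0) (suc i) ≡ 0
  ext-const0-suc i with suc i ≤? m
  ... | yes _ = refl
  ... | no  _ = refl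

  ext-constn : i ≤ m → ext m n (const n) i ≡ n
  ext-constn {i = zero}  _   = refl
  ext-constn {i = suc _} i≤m = ext-inner (const _) (s≤s z≤n) i≤m

  <ext-constn⇒ : j < ext m n (const n) i → i ≤ m × j < n
  <ext-constn⇒ {i = zero}  j<n = z≤n , j<n
  <ext-constn⇒ {i = suc k} j<e with suc k ≤? m
  ... | yes i≤m = i≤m , j<e

  IsEdge-d⇒row≤ : IsEdge m n (d i j) → i ≤ m
  IsEdge-d⇒row≤ (inj₁ (_ , i≤m , _)) = i≤m
  IsEdge-d⇒row≤ (inj₂ (i<m , _))     = ≤-trans (n≤1+n _) i<m

  IsEdge-d⇒col≤ : IsEdge m n (d i j) → j ≤ n
  IsEdge-d⇒col≤ (inj₁ (_ , _ , _ , j≤n)) = j≤n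
  IsEdge-d⇒col≤ (inj₂ (_ , j<n))         = ≤-trans (n≤1+n _) j<n

  both⇒Significant : 1 ≤ m → 1 ≤ n → ∀ e → IsEdge m n e →
    InP m n (const 0) e → InP m n (const n) e → Significant m n e
  both⇒Significant _ n≥1 (a (suc k) j) (_ , i≤m , _) j≡0 j≡n =
    contradiction (trans (sym j≡0') j≡n') (<⇒≢ n≥1)
    where
    j≡0' : j ≡ 0
    j≡0' = trans j≡0 (ext-const0-suc k)
    j≡n' : j ≡ n
    j≡n' = trans j≡n (ext-constn i≤m)
  both⇒Significant m≥1 _ (b zero j) _ _ (j≤n , n<j) =
    contradiction j≤n (<⇒≱ (subst (_< j) (ext-constn m≥1) n<j))
  both⇒Significant _ _ (b (suc k) j) (_ , j≥1 , _) (j≤0 , _) _ =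
    contradiction (subst (j ≤_) (ext-const0-suc k) j≤0) (<⇒≱ j≥1)
  both⇒Significant _ _ (d zero j) edge (inj₁ n<j) _ =
    contradiction (IsEdge-d⇒col≤ edge) (<⇒≱ n<j)
  both⇒Significant _ _ (d zero j) _ (inj₂ j<0) _ =
    contradiction (subst (j <_) (ext-const0-suc 0) j<0) λ ()
  both⇒Significant _ _ (d (suc k) j) edge _ (inj₁ n<j) =
    contradiction (IsEdge-d⇒col≤ edge)
      (<⇒≱ (subst (_< j) (ext-constn (IsEdge-d⇒row≤ edge)) n<j))
  both⇒Significant _ _ (d (suc k) j) _ bottom (inj₂ j<e)
    with <ext-constn⇒ j<e
  ... | i<m , j<n = suc k , j , refl , s≤s z≤n , <⇒≤pred i<m , j≥1 bottom , <⇒≤pred j<n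
    where
    j≥1 : InP m n (const 0) (d (suc k) j) → 1 ≤ j
    j≥1 (inj₁ 0<j) = subst (_< j) (ext-const0-suc k) 0<j
    j≥1 (inj₂ j<0) = contradiction (subst (j <_) (ext-const0-suc (suc k)) j<0) λ ()

  Significant⇒both : ∀ e → Significant m n e →
    InP m n (const 0) e × InP m n (const n) e
  Significant⇒both .(d (suc k) j) (suc k , j , refl , _ , i≤pred , j≥1 , j≤pred) =
    inj₁ (subst (_< j) (sym (ext-const0-suc k)) j≥1) ,
    inj₂ (subst (j <_) (sym (ext-constn (≤pred⇒< (s≤s z≤n) i≤pred))) (≤pred⇒< j≥1 j≤pred))

lemma3p9 : (m n : ℕ) → 2 ≤ m → 2 ≤ n → (e : Label) → IsEdge m n e →
    (InP m n (λ _ → 0) e × InP m n (λ _ → n) e) ⇔ Significant m n e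
lemma3p9 m n m≥2 n≥2 e edge =
  mk⇔ (uncurry (both⇒Significant m n (≤-trans (n≤1+n 1) m≥2) (≤-trans (n≤1+n 1) n≥2) e edge))
      (Significant⇒both m n e)
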